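{- Let $k \geq 2$ and $\ell \geq 1$ be integers. Let $D$ be a digraph with $\delta^+(D) \geq k$ and digirth at least $\frac{k^\ell - 1}{k - 1}+1$. Then for every vertex $u$ of $D$, $D$ contains a copy of $S_k^{+(\ell)}$ with centre $u$.
   Context: Digraphs are finite, without loops or parallel arcs. $\delta^+(D)$ is the minimum out-degree. The digirth of $D$ is the length of a shortest directed cycle ($+\infty$ if acyclic). $S_k^{+(\ell)}$ is the digraph consisting of $k$ directed paths of length $\ell$ (i.e. with $\ell$ arcs) sharing their initial vertex and having no other common vertices; its centre is this common initial vertex (its unique source). A copy of it in $D$ is a subdigraph of $D$ isomorphic to it. -}

module Defs where

open import Data.Nat using (ℕ; zero; suc; _+_; _*_; _^_; _≤_)
open import Data.Fin using (Fin; zero; suc; inject₁; fromℕ)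
open import Data.Product using (Σ; _×_; _,_)
open import Data.Sum using (_⊎_)
open import Relation.Binary.PropositionalEquality using (_≡_)
open import Relation.Nullary using (¬_)
open import Function.Definitions using (Injective)

-- A finite digraph without loops on vertex set Fin n; arcs form a relation
-- (so there are no parallel arcs).
record Digraph : Set₁ where
  field
    n        : ℕ
    Arc      : Fin n → Fin n → Set
    loopless : ∀ v → ¬ Arc v v

open Digraph public

MinOutDeg≥ : Digraph → ℕ → Set
MinOutDeg≥ D k = ∀ v → Σ (Fin k → Fin (n D)) λ f →
  Injective _≡_ _≡_ f × (∀ i → Arc D v (f i))

-- A directed cycle of length (suc m): distinct vertices c 0, …, c m with
-- arcs c i → c (i+1) for i < m and c m → c 0.
DirCycle : (D : Digraph) → ℕ → Set
DirCycle D m = Σ (Fin (suc m) → Fin (n D)) λ c →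
  Injective _≡_ _≡_ c ×
  ((∀ (i : Fin m) → Arc D (c (inject₁ i)) (c (suc i))) × Arc D (c (fromℕ m)) (c zero))

-- digirth(D) ≥ g : every directed cycle has length ≥ g (vacuous if acyclic,
-- matching digirth = +∞).
Digirth≥ : Digraph → ℕ → Set
Digirth≥ D g = ∀ m → DirCycle D m → g ≤ suc m

-- 1 + k + … + k^(ℓ-1), which equals (k^ℓ - 1)/(k - 1) for k ≥ 2.
geomSum : ℕ → ℕ → ℕ
geomSum k zero    = zero
geomSum k (suc ℓ) = k ^ ℓ + geomSum k ℓ

OutSpiderAt : (D : Digraph) → ℕ → ℕ → Fin (n D) → Set
OutSpiderAt D k ℓ u = Σ (Fin k → Fin (suc ℓ) → Fin (n D)) λ p →
  (∀ i → p i zero ≡ u) ×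
  ((∀ i (j : Fin ℓ) → Arc D (p i (inject₁ j)) (p i (suc j))) ×
   (∀ i j i' j' → p i j ≡ p i' j' → (j ≡ zero × j' ≡ zero) ⊎ (i ≡ i' × j ≡ j')))

{-# OPTIONS --safe #-}
-- Fix k distinct out-neighbours of every vertex ("chosen arcs"). A nonempty list W
-- of vertices shorter than the digirth contains a sink, a member none of whose chosen
-- out-neighbours is in W: otherwise chosen arcs inside W close a walk, hence a cycle,
-- of length at most |W|. By induction on |W|, removing a sink z, from every x ∈ W
-- there are k paths along chosen arcs, disjoint apart from x, that stay in W up to
-- their last vertex, which lies outside W: if z ends one of the paths for W − z,
-- extend it by an out-neighbour of z that ends none of the other k − 1 paths.
-- Taking for W the vertices reached from u by at most ℓ − 1 chosen arcs, listed with
-- multiplicity so that |W| = 1 + k + … + k^(ℓ-1), every such path has length ≥ ℓ.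
module Submission where

open import Defs
open import Data.Nat using (ℕ; _≤_; _+_)
open import Data.Fin using (Fin)

open import Data.Nat using (zero; suc; _<_; _*_; _^_; z≤n; s≤s; z<s; _≤?_)
import Data.Nat.Properties as ℕ
open import Data.Nat.Induction using (<-wellFounded)
open import Induction.WellFounded using (Acc; acc)
open import Data.Fin as Fin using (toℕ; inject₁; fromℕ; punchOut; _≟_)
import Data.Fin.Properties as Finₚ
open import Data.List using (List; []; _∷_; [_]; _++_; length; lookup; filter; tabulate; concatMap)
import Data.List.Properties as Listₚ
open import Data.List.Membership.Propositional using (_∈_; _∉_; find)
open import Data.List.Membership.Propositional.Properties
  using (∈-filter⁺; ∈-filter⁻; ∈-tabulate⁺; ∈-concatMap⁺; ∈-++⁺ˡ; ∈-++⁺ʳ)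
open import Data.List.Relation.Unary.Any as Any using (here; index)
open import Data.List.Relation.Unary.Any.Properties using (lookup-index)
open import Data.Product using (Σ; ∃; ∃₂; _×_; _,_; proj₁; proj₂)
open import Data.Sum using (_⊎_; inj₁; inj₂)
open import Data.Empty using (⊥-elim)
open import Data.Vec.Functional using (updateAt)
open import Data.Vec.Functional.Properties using (updateAt-updates; updateAt-minimal)
open import Function using (_∘_)
open import Function.Definitions using (Injective)
open import Relation.Binary using (tri<; tri≈; tri>)
open import Relation.Binary.PropositionalEquality
  using (_≡_; _≢_; refl; sym; trans; cong; cong₂; subst; subst₂; module ≡-Reasoning)
open import Relation.Nullary using (¬_; yes; no; ¬?; _×-dec_)
open import Relation.Nullary.Decidable using (decidable-stable)
open import Relation.Unary using (Decidable)

injective⇒surjective : ∀ {m} {h : Fin m → Fin m} → Injective _≡_ _≡_ h → ∀ i → ∃ λ t → h t ≡ i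
injective⇒surjective {suc m} {h} h-injective i with Finₚ.any? (λ t → h t ≟ i)
... | yes hit = hit
... | no miss = ⊥-elim (Finₚ.<⇒notInjective {f = squeeze} ℕ.≤-refl squeeze-injective)
  where
  i≢h : ∀ t → i ≢ h t
  i≢h t i≡ht = miss (t , sym i≡ht)
  squeeze : Fin (suc m) → Fin m
  squeeze t = punchOut (i≢h t)
  squeeze-injective : Injective _≡_ _≡_ squeeze
  squeeze-injective {s} {t} eq = h-injective (Finₚ.punchOut-injective (i≢h s) (i≢h t) eq)

injective⇒avoids-all-but-one : ∀ {k n} {f : Fin k → Fin n} → Injective _≡_ _≡_ f →
  (e : Fin k → Fin n) (i₀ : Fin k) → ∃ λ t → ∀ i → i ≢ i₀ → f t ≢ e i
injective⇒avoids-all-but-one {k} {f = f} f-injective e i₀ =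
  let t , miss = decidable-stable (Finₚ.any? (¬? ∘ hit?)) everyHit⇒⊥
  in t , λ i i≢i₀ ft≡ei → miss (i , i≢i₀ , ft≡ei)
  where
  Hit : Fin k → Set
  Hit t = ∃ λ i → i ≢ i₀ × f t ≡ e i
  hit? : Decidable Hit
  hit? t = Finₚ.any? (λ i → ¬? (i ≟ i₀) ×-dec (f t ≟ e i))
  everyHit⇒⊥ : ¬ ¬ ∃ (¬_ ∘ Hit)
  everyHit⇒⊥ someMiss =
    let t , ht≡i₀ = injective⇒surjective h-injective i₀ in proj₁ (proj₂ (cover t)) ht≡i₀
    where
    cover : ∀ t → Hit t
    cover t = decidable-stable (hit? t) (λ miss → someMiss (t , miss))
    h-injective : Injective _≡_ _≡_ (proj₁ ∘ cover)
    h-injective {s} {t} eq = f-injective (begin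
      f s               ≡⟨ proj₂ (proj₂ (cover s)) ⟩
      e (proj₁ (cover s)) ≡⟨ cong e eq ⟩
      e (proj₁ (cover t)) ≡⟨ proj₂ (proj₂ (cover t)) ⟨
      f t               ∎)
      where open ≡-Reasoning

window-repeat : ∀ {A : Set} (w : ℕ → A) i {L} {a b : Fin (suc L)} → a Fin.< b →
  w (i + toℕ a) ≡ w (i + toℕ b) → ∃ λ d → d < L × w (i + toℕ a) ≡ w (i + toℕ a + suc d)
window-repeat w i {L} {a} {b} a<b repeat with d , 1+a+d≡b ← ℕ.m≤n⇒∃[o]m+o≡n a<b =
  d , d<L , (begin
    w (i + toℕ a)           ≡⟨ repeat ⟩
    w (i + toℕ b)           ≡⟨ cong (λ c → w (i + c)) 1+a+d≡b ⟨
    w (i + suc (toℕ a + d)) ≡⟨ cong (λ c → w (i + c)) (ℕ.+-suc (toℕ a) d) ⟨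
    w (i + (toℕ a + suc d)) ≡⟨ cong w (ℕ.+-assoc i (toℕ a) (suc d)) ⟨
    w (i + toℕ a + suc d)   ∎)
  where
  open ≡-Reasoning
  d<L : d < L
  d<L = ℕ.≤-trans (s≤s (ℕ.m≤n+m d (toℕ a)))
                  (ℕ.≤-trans (ℕ.≤-reflexive 1+a+d≡b) (Finₚ.toℕ≤pred[n] b))

injective-or-repeat : ∀ {m n} (f : Fin m → Fin n) →
  Injective _≡_ _≡_ f ⊎ ∃₂ λ a b → a Fin.< b × f a ≡ f b
injective-or-repeat f with Finₚ.any? (λ a → Finₚ.any? (λ b → (a Finₚ.<? b) ×-dec (f a ≟ f b)))
... | yes repeat = inj₂ repeat
... | no noRepeat = inj₁ injective
  where
  injective : Injective _≡_ _≡_ f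
  injective {a} {b} fa≡fb with Finₚ.<-cmp a b
  ... | tri< a<b _ _ = ⊥-elim (noRepeat (a , b , a<b , fa≡fb))
  ... | tri≈ _ a≡b _ = a≡b
  ... | tri> _ _ b<a = ⊥-elim (noRepeat (b , a , b<a , sym fa≡fb))

IsWalk : (D : Digraph) → (ℕ → Fin (n D)) → Set
IsWalk D w = ∀ a → Arc D (w a) (w (suc a))

module _ {D : Digraph} {w : ℕ → Fin (n D)} (walk : IsWalk D w) where

  injective-closedWalk⇒DirCycle : ∀ L i → w i ≡ w (i + suc L) →
    Injective _≡_ _≡_ (λ (t : Fin (suc L)) → w (i + toℕ t)) → DirCycle D L
  injective-closedWalk⇒DirCycle L i closed injective = _ , injective , arcs , last
    where
    arcs : ∀ (t : Fin L) → Arc D (w (i + toℕ (inject₁ t))) (w (i + suc (toℕ t)))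
    arcs t rewrite Finₚ.toℕ-inject₁ t | ℕ.+-suc i (toℕ t) = walk (i + toℕ t)
    last : Arc D (w (i + toℕ (fromℕ L))) (w (i + 0))
    last rewrite Finₚ.toℕ-fromℕ L | ℕ.+-identityʳ i | closed | ℕ.+-suc i L = walk (i + L)

  closedWalk⇒DirCycle : ∀ L i → w i ≡ w (i + suc L) → ∃ λ m → m ≤ L × DirCycle D m
  closedWalk⇒DirCycle L = go L (<-wellFounded L)
    where
    go : ∀ L → Acc _<_ L → ∀ i → w i ≡ w (i + suc L) → ∃ λ m → m ≤ L × DirCycle D m
    go L (acc shorter) i closed with injective-or-repeat (λ (t : Fin (suc L)) → w (i + toℕ t))
    ... | inj₁ injective = L , ℕ.≤-refl , injective-closedWalk⇒DirCycle L i closed injective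
    ... | inj₂ (a , b , a<b , repeat) =
      let d , d<L , closed′ = window-repeat w i a<b repeat
          m , m≤d , cycle = go d (shorter d<L) (i + toℕ a) closed′
      in m , ℕ.≤-trans m≤d (ℕ.<⇒≤ d<L) , cycle

  digirth≤closedWalk-length : ∀ {B} → Digirth≥ D B → ∀ L i → w i ≡ w (i + suc L) → B ≤ suc L
  digirth≤closedWalk-length digirth L i closed =
    let m , m≤L , cycle = closedWalk⇒DirCycle L i closed in ℕ.≤-trans (digirth m cycle) (s≤s m≤L)

sequence-in-list-repeats : ∀ {A : Set} (W : List A) (s : ℕ → A) → (∀ a → s a ∈ W) →
  ∃₂ λ i d → d < length W × s i ≡ s (i + suc d)
sequence-in-list-repeats W s s∈W
  with a , b , a<b , sameIndex ←
         Finₚ.pigeonhole ℕ.≤-refl (λ (a : Fin (suc (length W))) → index (s∈W (toℕ a))) =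
  toℕ a , window-repeat s 0 a<b (begin
    s (toℕ a)                      ≡⟨ lookup-index (s∈W (toℕ a)) ⟩
    lookup W (index (s∈W (toℕ a))) ≡⟨ cong (lookup W) sameIndex ⟩
    lookup W (index (s∈W (toℕ b))) ≡⟨ lookup-index (s∈W (toℕ b)) ⟨
    s (toℕ b)                      ∎)
  where open ≡-Reasoning

module OutNeighbours {D : Digraph} {k : ℕ} (δ⁺≥k : MinOutDeg≥ D k) where

  private
    V : Set
    V = Fin (n D)

  open import Data.List.Membership.DecPropositional (_≟_ {n D}) using (_∈?_)

  out : V → Fin k → V
  out v = proj₁ (δ⁺≥k v)

  out-injective : ∀ v → Injective _≡_ _≡_ (out v)
  out-injective v = proj₁ (proj₂ (δ⁺≥k v))

  out-arc : ∀ v t → Arc D v (out v t)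
  out-arc v = proj₂ (proj₂ (δ⁺≥k v))

  _⟶_ : V → V → Set
  v ⟶ y = ∃ λ t → out v t ≡ y

  ⟶⇒Arc : ∀ {v y} → v ⟶ y → Arc D v y
  ⟶⇒Arc (t , refl) = out-arc _ t

  IsSinkIn : List V → V → Set
  IsSinkIn W z = ∀ t → out z t ∉ W

  out-closed⇒digirth≤length : ∀ {B} → Digirth≥ D B → {W : List V} →
    (∀ {z} → z ∈ W → ∃ λ t → out z t ∈ W) → ∀ {x} → x ∈ W → B ≤ length W
  out-closed⇒digirth≤length digirth {W} successor {x} x∈W =
    let i , d , d<|W| , closed = sequence-in-list-repeats W (proj₁ ∘ walkIn) (proj₂ ∘ walkIn)
    in ℕ.≤-trans (digirth≤closedWalk-length {D = D} {w = proj₁ ∘ walkIn} walk digirth d i closed)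
                 d<|W|
    where
    walkIn : ℕ → Σ V (_∈ W)
    walkIn zero = x , x∈W
    walkIn (suc a) = let z , z∈W = walkIn a ; t , next∈W = successor z∈W in out z t , next∈W
    walk : IsWalk D (proj₁ ∘ walkIn)
    walk a = out-arc _ _

  sink-exists : ∀ {B} → Digirth≥ D B → (W : List V) → length W < B →
    ∀ {x} → x ∈ W → ∃ λ z → z ∈ W × IsSinkIn W z
  sink-exists digirth W |W|<B x∈W with Any.any? (λ z → Finₚ.all? (λ t → ¬? (out z t ∈? W))) W
  ... | yes sink = find sink
  ... | no noSink = ⊥-elim (ℕ.<⇒≱ |W|<B (out-closed⇒digirth≤length digirth successor x∈W))
    where
    successor : ∀ {z} → z ∈ W → ∃ λ t → out z t ∈ W
    successor z∈W = decidable-stable (Finₚ.any? (λ t → out _ t ∈? W))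
      (λ noSuccessor → noSink (Any.map (λ { refl t → noSuccessor ∘ (t ,_) }) z∈W))

  record Fan (x : V) : Set where
    field
      len      : Fin k → ℕ
      path     : Fin k → ℕ → V
      start    : ∀ i → path i 0 ≡ x
      step     : ∀ i a → a < len i → path i a ⟶ path i (suc a)
      disjoint : ∀ i j a b → a ≤ len i → b ≤ len j → path i a ≡ path j b →
                 (a ≡ 0 × b ≡ 0) ⊎ (i ≡ j × a ≡ b)

    end : Fin k → V
    end i = path i (len i)

    end-injective : ∀ {i j} → end j ≢ x → end i ≡ end j → i ≡ j
    end-injective {i} {j} end≢x ends≡ with disjoint i j (len i) (len j) ℕ.≤-refl ℕ.≤-refl ends≡
    ... | inj₁ (_ , len≡0) = ⊥-elim (end≢x (trans (cong (path j) len≡0) (start j)))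
    ... | inj₂ (i≡j , _) = i≡j

  Exits : List V → ∀ {x} → Fan x → Set
  Exits W F = (∀ i a → a < len i → path i a ∈ W) × (∀ i → end i ∉ W)
    where open Fan F

  star : (x : V) → Fan x
  star x = record { len = λ _ → 1 ; path = path ; start = λ _ → refl ; step = step ; disjoint = disjoint }
    where
    path : Fin k → ℕ → V
    path i zero    = x
    path i (suc _) = out x i
    step : ∀ i a → a < 1 → path i a ⟶ path i (suc a)
    step i zero    _         = i , refl
    step i (suc _) (s≤s ())
    disjoint : ∀ i j a b → a ≤ 1 → b ≤ 1 → path i a ≡ path j b → (a ≡ 0 × b ≡ 0) ⊎ (i ≡ j × a ≡ b)
    disjoint i j 0 0 _ _ _ = inj₁ (refl , refl)
    disjoint i j 0 1 _ _ x≡out = ⊥-elim (loopless D x (subst (Arc D x) (sym x≡out) (out-arc x j)))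
    disjoint i j 1 0 _ _ out≡x = ⊥-elim (loopless D x (subst (Arc D x) out≡x (out-arc x i)))
    disjoint i j 1 1 _ _ out≡out = inj₂ (out-injective x out≡out , refl)
    disjoint i j (suc (suc _)) _ (s≤s ()) _ _
    disjoint i j _ (suc (suc _)) _ (s≤s ()) _

  star-exits : ∀ {W x} → x ∈ W → IsSinkIn W x → Exits W (star x)
  star-exits x∈W sink = (λ { i zero _ → x∈W ; i (suc _) (s≤s ()) }) , sink

  module Extend {x} (F : Fan x) (i₀ : Fin k) {y : V} (arc : Fan.end F i₀ ⟶ y)
                (fresh : ∀ j b → b ≤ Fan.len F j → Fan.path F j b ≢ y) where
    open Fan F

    len′ : Fin k → ℕ
    len′ = updateAt len i₀ suc

    path′ : Fin k → ℕ → V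
    path′ i a with a ≤? len i
    ... | yes _ = path i a
    ... | no  _ = y

    path′-old : ∀ i {a} → a ≤ len i → path′ i a ≡ path i a
    path′-old i {a} a≤len with a ≤? len i
    ... | yes _    = refl
    ... | no  a≰len = ⊥-elim (a≰len a≤len)

    path′-new : ∀ i → path′ i (suc (len i)) ≡ y
    path′-new i with suc (len i) ≤? len i
    ... | yes 1+len≤len = ⊥-elim (ℕ.<-irrefl refl 1+len≤len)
    ... | no  _         = refl

    len′-i₀ : len′ i₀ ≡ suc (len i₀)
    len′-i₀ = updateAt-updates i₀ len

    len′-other : ∀ {i} → i ≢ i₀ → len′ i ≡ len i
    len′-other {i} i≢i₀ = updateAt-minimal i i₀ len i≢i₀

    position : ∀ i a → a ≤ len′ i → a ≤ len i ⊎ (i ≡ i₀ × a ≡ suc (len i))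
    position i a a≤len′ with i ≟ i₀
    ... | no i≢i₀ = inj₁ (subst (a ≤_) (len′-other i≢i₀) a≤len′)
    ... | yes refl with ℕ.m≤n⇒m<n∨m≡n (subst (a ≤_) len′-i₀ a≤len′)
    ...   | inj₁ a<1+len = inj₁ (ℕ.≤-pred a<1+len)
    ...   | inj₂ a≡1+len = inj₂ (refl , a≡1+len)

    fan : Fan x
    fan = record { len = len′ ; path = path′ ; start = start′ ; step = step′ ; disjoint = disjoint′ }
      where
      start′ : ∀ i → path′ i 0 ≡ x
      start′ i = trans (path′-old i z≤n) (start i)
      step′ : ∀ i a → a < len′ i → path′ i a ⟶ path′ i (suc a)
      step′ i a a<len′ with position i (suc a) a<len′
      ... | inj₁ a<len =
        subst₂ _⟶_ (sym (path′-old i (ℕ.<⇒≤ a<len))) (sym (path′-old i a<len)) (step i a a<len)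
      ... | inj₂ (refl , refl) = subst₂ _⟶_ (sym (path′-old i₀ ℕ.≤-refl)) (sym (path′-new i₀)) arc
      disjoint′ : ∀ i j a b → a ≤ len′ i → b ≤ len′ j → path′ i a ≡ path′ j b →
                  (a ≡ 0 × b ≡ 0) ⊎ (i ≡ j × a ≡ b)
      disjoint′ i j a b a≤ b≤ eq with position i a a≤ | position j b b≤
      ... | inj₁ a≤len | inj₁ b≤len =
        disjoint i j a b a≤len b≤len (trans (sym (path′-old i a≤len)) (trans eq (path′-old j b≤len)))
      ... | inj₁ a≤len | inj₂ (refl , refl) =
        ⊥-elim (fresh i a a≤len (trans (sym (path′-old i a≤len)) (trans eq (path′-new j))))
      ... | inj₂ (refl , refl) | inj₁ b≤len =
        ⊥-elim (fresh j b b≤len (trans (sym (path′-old j b≤len)) (trans (sym eq) (path′-new i))))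
      ... | inj₂ (refl , refl) | inj₂ (refl , refl) = inj₂ (refl , refl)

    end′-i₀ : path′ i₀ (len′ i₀) ≡ y
    end′-i₀ = trans (cong (path′ i₀) len′-i₀) (path′-new i₀)

    end′-other : ∀ {i} → i ≢ i₀ → path′ i (len′ i) ≡ end i
    end′-other {i} i≢i₀ = trans (cong (path′ i) (len′-other i≢i₀)) (path′-old i ℕ.≤-refl)

  remove : V → List V → List V
  remove z = filter (λ y → ¬? (y ≟ z))

  ∈-remove⁺ : ∀ {z y W} → y ∈ W → y ≢ z → y ∈ remove z W
  ∈-remove⁺ {z} = ∈-filter⁺ (λ y → ¬? (y ≟ z))

  ∈-remove⁻ : ∀ {z y W} → y ∈ remove z W → y ∈ W
  ∈-remove⁻ {z} = proj₁ ∘ ∈-filter⁻ (λ y → ¬? (y ≟ z))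

  remove-shorter : ∀ {z W} → z ∈ W → length (remove z W) < length W
  remove-shorter {z} {W} z∈W =
    Listₚ.filter-notAll (λ y → ¬? (y ≟ z)) W (Any.map (λ { refl z≢z → z≢z refl }) z∈W)

  ∉-remove : ∀ {z y W} → y ∉ remove z W → y ≢ z → y ∉ W
  ∉-remove y∉ y≢z y∈W = y∉ (∈-remove⁺ y∈W y≢z)

  module _ {W : List V} {x z : V} (z∈W : z ∈ W) (sink : IsSinkIn W z) (z≢x : z ≢ x) where

    exits-without-end : ∀ {F : Fan x} → Exits (remove z W) F → (∀ i → Fan.end F i ≢ z) → Exits W F
    exits-without-end (inside , outside) end≢z =
      (λ i a a<len → ∈-remove⁻ (inside i a a<len)) , λ i → ∉-remove (outside i) (end≢z i)

    exits-with-end : ∀ {F : Fan x} → Exits (remove z W) F → ∀ {i₀} → Fan.end F i₀ ≡ z →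
                     Σ (Fan x) (Exits W)
    exits-with-end {F} (inside , outside) {i₀} end≡z
      with t , avoids ← injective⇒avoids-all-but-one (out-injective z) (Fan.end F) i₀ =
      fan , inside′ , outside′
      where
      open Fan F
      fresh : ∀ j b → b ≤ len j → path j b ≢ out z t
      fresh j b b≤len with ℕ.m≤n⇒m<n∨m≡n b≤len
      ... | inj₁ b<len = λ p≡y → sink t (subst (_∈ W) p≡y (∈-remove⁻ (inside j b b<len)))
      ... | inj₂ refl with j ≟ i₀
      ...   | yes refl = λ end≡y → sink t (subst (_∈ W) (trans (sym end≡z) end≡y) z∈W)
      ...   | no j≢i₀ = λ end≡y → avoids j j≢i₀ (sym end≡y)
      open Extend F i₀ (t , cong (λ v → out v t) end≡z) fresh
      inside′ : ∀ i a → a < len′ i → path′ i a ∈ W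
      inside′ i a a<len′ with position i (suc a) a<len′
      ... | inj₁ a<len =
        subst (_∈ W) (sym (path′-old i (ℕ.<⇒≤ a<len))) (∈-remove⁻ (inside i a a<len))
      ... | inj₂ (refl , refl) = subst (_∈ W) (sym (trans (path′-old i₀ ℕ.≤-refl) end≡z)) z∈W
      other-end≢z : ∀ {i} → i ≢ i₀ → end i ≢ z
      other-end≢z i≢i₀ end≡z′ =
        i≢i₀ (end-injective (z≢x ∘ trans (sym end≡z)) (trans end≡z′ (sym end≡z)))
      outside′ : ∀ i → path′ i (len′ i) ∉ W
      outside′ i with i ≟ i₀
      ... | yes refl = subst (_∉ W) (sym end′-i₀) (sink t)
      ... | no i≢i₀  = subst (_∉ W) (sym (end′-other i≢i₀)) (∉-remove (outside i) (other-end≢z i≢i₀))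

    grow : Σ (Fan x) (Exits (remove z W)) → Σ (Fan x) (Exits W)
    grow (F , exits) with Finₚ.any? (λ i → Fan.end F i ≟ z)
    ... | no  noEnd        = F , exits-without-end {F = F} exits (λ i end≡z → noEnd (i , end≡z))
    ... | yes (i₀ , end≡z) = exits-with-end {F = F} exits end≡z

  exiting-fan : ∀ {B} → Digirth≥ D B → (W : List V) → length W < B →
               ∀ {x} → x ∈ W → Σ (Fan x) (Exits W)
  exiting-fan {B} digirth W = go W (<-wellFounded (length W))
    where
    go : (W : List V) → Acc _<_ (length W) → length W < B → ∀ {x} → x ∈ W → Σ (Fan x) (Exits W)
    go W (acc shorter) |W|<B {x} x∈W with sink-exists digirth W |W|<B x∈W
    ... | z , z∈W , sink with z ≟ x
    ...   | yes refl = star z , star-exits z∈W sink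
    ...   | no  z≢x  = grow z∈W sink z≢x
      (go (remove z W) (shorter (remove-shorter z∈W)) (ℕ.<-trans (remove-shorter z∈W) |W|<B)
          (∈-remove⁺ x∈W (z≢x ∘ sym)))

  Fan⇒OutSpider : ∀ {x} ℓ (F : Fan x) → (∀ i → ℓ ≤ Fan.len F i) → OutSpiderAt D k ℓ x
  Fan⇒OutSpider ℓ F long = (λ i j → path i (toℕ j)) , start , arcs , distinct
    where
    open Fan F
    within : ∀ i (j : Fin (suc ℓ)) → toℕ j ≤ len i
    within i j = ℕ.≤-trans (Finₚ.toℕ≤pred[n] j) (long i)
    arcs : ∀ i (j : Fin ℓ) → Arc D (path i (toℕ (inject₁ j))) (path i (suc (toℕ j)))
    arcs i j rewrite Finₚ.toℕ-inject₁ j = ⟶⇒Arc (step i (toℕ j) (ℕ.<-≤-trans (Finₚ.toℕ<n j) (long i)))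
    distinct : ∀ i j i′ j′ → path i (toℕ j) ≡ path i′ (toℕ j′) →
               (j ≡ Fin.zero × j′ ≡ Fin.zero) ⊎ (i ≡ i′ × j ≡ j′)
    distinct i j i′ j′ eq with disjoint i i′ (toℕ j) (toℕ j′) (within i j) (within i′ j′) eq
    ... | inj₁ (j≡0 , j′≡0)  = inj₁ (Finₚ.toℕ-injective j≡0 , Finₚ.toℕ-injective j′≡0)
    ... | inj₂ (i≡i′ , j≡j′) = inj₂ (i≡i′ , Finₚ.toℕ-injective j≡j′)

  length-concatMap-out : ∀ vs → length (concatMap (tabulate ∘ out) vs) ≡ k * length vs
  length-concatMap-out []       = sym (ℕ.*-zeroʳ k)
  length-concatMap-out (v ∷ vs) = begin
    length (tabulate (out v) ++ concatMap (tabulate ∘ out) vs)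
      ≡⟨ Listₚ.length-++ (tabulate (out v)) ⟩
    length (tabulate (out v)) + length (concatMap (tabulate ∘ out) vs)
      ≡⟨ cong₂ _+_ (Listₚ.length-tabulate (out v)) (length-concatMap-out vs) ⟩
    k + k * length vs
      ≡⟨ ℕ.*-suc k (length vs) ⟨
    k * suc (length vs) ∎
    where open ≡-Reasoning

  module Layers (u : V) where

    layer : ℕ → List V
    layer zero    = [ u ]
    layer (suc a) = concatMap (tabulate ∘ out) (layer a)

    ball : ℕ → List V
    ball zero    = []
    ball (suc a) = layer a ++ ball a

    length-layer : ∀ a → length (layer a) ≡ k ^ a
    length-layer zero    = refl
    length-layer (suc a) = trans (length-concatMap-out (layer a)) (cong (k *_) (length-layer a))

    length-ball : ∀ a → length (ball a) ≡ geomSum k a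
    length-ball zero    = refl
    length-ball (suc a) = trans (Listₚ.length-++ (layer a)) (cong₂ _+_ (length-layer a) (length-ball a))

    layer-⟶ : ∀ {a v y} → v ∈ layer a → v ⟶ y → y ∈ layer (suc a)
    layer-⟶ v∈layer (t , refl) =
      ∈-concatMap⁺ (tabulate ∘ out) (Any.map (λ { refl → ∈-tabulate⁺ t }) v∈layer)

    layer⊆ball : ∀ {a ℓ v} → a < ℓ → v ∈ layer a → v ∈ ball ℓ
    layer⊆ball {a} {suc ℓ} a<1+ℓ v∈layer with ℕ.m<1+n⇒m<n∨m≡n a<1+ℓ
    ... | inj₁ a<ℓ  = ∈-++⁺ʳ (layer ℓ) (layer⊆ball a<ℓ v∈layer)
    ... | inj₂ refl = ∈-++⁺ˡ v∈layer

    path-in-layer : (F : Fan u) → ∀ i a → a ≤ Fan.len F i → Fan.path F i a ∈ layer a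
    path-in-layer F i zero    _     = subst (_∈ layer 0) (sym (Fan.start F i)) (here refl)
    path-in-layer F i (suc a) a<len =
      layer-⟶ {a} (path-in-layer F i a (ℕ.<⇒≤ a<len)) (Fan.step F i a a<len)

    exits-ball⇒long : ∀ ℓ (F : Fan u) → Exits (ball ℓ) F → ∀ i → ℓ ≤ Fan.len F i
    exits-ball⇒long ℓ F (_ , outside) i = ℕ.≮⇒≥ λ len<ℓ →
      outside i (layer⊆ball len<ℓ (path-in-layer F i (Fan.len F i) ℕ.≤-refl))

theorem8 : (k ℓ : ℕ) → 2 ≤ k → 1 ≤ ℓ → (D : Digraph) →
    MinOutDeg≥ D k → Digirth≥ D (geomSum k ℓ + 1) →
    (u : Fin (n D)) → OutSpiderAt D k ℓ u
theorem8 k ℓ _ 1≤ℓ D δ⁺≥k digirth u =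
  let F , exits = exiting-fan digirth (ball ℓ) |ball|<digirth (layer⊆ball 1≤ℓ (here refl))
  in Fan⇒OutSpider ℓ F (exits-ball⇒long ℓ F exits)
  where
  open OutNeighbours {D} δ⁺≥k
  open Layers u
  |ball|<digirth : length (ball ℓ) < geomSum k ℓ + 1
  |ball|<digirth = subst (_< geomSum k ℓ + 1) (sym (length-ball ℓ)) (ℕ.m<m+n (geomSum k ℓ) z<s)
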